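{- Let $\mathbf{A}$ be a relevant algebra and $a,b\in A$. Then (i) $|\,|a|\wedge|b|\,|\leqslant |a|\wedge|b|$; (ii) $\mathit{DFg}^{\mathbf{A}}\{a\}=\{c\in A: a\wedge|d|\leqslant c\text{ for some } d\in A\}$; (iii) $\mathit{DFg}^{\mathbf{A}}\{a\}\cap\mathit{DFg}^{\mathbf{A}}\{b\}=\mathit{DFg}^{\mathbf{A}}\{a\vee b\}$.
   Context: A relevant algebra is an algebra $\langle A;\cdot,\wedge,\vee,\neg\rangle$ such that $\langle A;\cdot\rangle$ is a commutative semigroup, $\langle A;\wedge,\vee\rangle$ is a distributive lattice with order $\leqslant$, and for all $a,b,c$: $\neg\neg a=a\leqslant a\cdot a$; $a\leqslant b$ iff $\neg b\leqslant\neg a$; $a\cdot b\leqslant c$ iff $a\cdot\neg c\leqslant\neg b$; $a\leqslant a\cdot(\neg(b\cdot\neg b)\wedge\neg(c\cdot\neg c))$. Define $x\to y:=\neg(x\cdot\neg y)$ and $|x|:=x\to x$. A deductive filter of $\mathbf{A}$ is a lattice filter $F$ of $\langle A;\wedge,\vee\rangle$ such that $|a|\in F$ for all $a\in A$. $\mathit{DFg}^{\mathbf{A}}X$ denotes the smallest deductive filter of $\mathbf{A}$ containing $X\subseteq A$. -}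

module Defs where

open import Level using (Level; suc; _⊔_)
open import Data.Product using (_×_; ∃; Σ; _,_)
open import Function.Bundles using (_⇔_)
open import Relation.Binary.PropositionalEquality using (_≡_)
open import Algebra.Core using (Op₁; Op₂)
open import Algebra.Structures using (IsCommutativeSemigroup)
open import Algebra.Lattice.Structures using (IsDistributiveLattice)

record RelevantAlgebra (a : Level) : Set (suc a) where
  infixl 7 _·_
  infixr 6 _∧_
  infixr 5 _∨_
  infix 4 _≤_
  field
    Carrier : Set a
    _·_ : Op₂ Carrier
    _∧_ : Op₂ Carrier
    _∨_ : Op₂ Carrier
    ¬_  : Op₁ Carrier
    ·-isCommutativeSemigroup : IsCommutativeSemigroup _≡_ _·_
    isDistributiveLattice    : IsDistributiveLattice _≡_ _∨_ _∧_

  _≤_ : Carrier → Carrier → Set a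
  x ≤ y = x ∧ y ≡ x

  field
    ¬¬-involutive : ∀ x → ¬ (¬ x) ≡ x
    square-increasing : ∀ x → x ≤ x · x
    ¬-antitone : ∀ x y → (x ≤ y → ¬ y ≤ ¬ x) × (¬ y ≤ ¬ x → x ≤ y)
    residuation : ∀ x y z → (x · y ≤ z → x · ¬ z ≤ ¬ y) × (x · ¬ z ≤ ¬ y → x · y ≤ z)
    identity-bound : ∀ x y z → x ≤ x · ((¬ (y · ¬ y)) ∧ (¬ (z · ¬ z)))

  _⇒_ : Op₂ Carrier
  x ⇒ y = ¬ (x · ¬ y)

  ∣_∣ : Op₁ Carrier
  ∣ x ∣ = x ⇒ x

module _ {a : Level} (𝐀 : RelevantAlgebra a) where
  open RelevantAlgebra 𝐀

  Subset : Set (suc a)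
  Subset = Carrier → Set a

  _⊆_ : Subset → Subset → Set a
  X ⊆ Y = ∀ x → X x → Y x

  _≐_ : Subset → Subset → Set a
  X ≐ Y = (X ⊆ Y) × (Y ⊆ X)

  record IsLatticeFilter (F : Subset) : Set a where
    field
      nonempty : ∃ λ x → F x
      up-closed : ∀ x y → F x → x ≤ y → F y
      ∧-closed : ∀ x y → F x → F y → F (x ∧ y)

  record IsDeductiveFilter (F : Subset) : Set a where
    field
      isLatticeFilter : IsLatticeFilter F
      contains-abs : ∀ x → F ∣ x ∣

  DFg : Subset → Carrier → Set (suc a)
  DFg X c = (F : Subset) → IsDeductiveFilter F → X ⊆ F → F c

  singleton : Carrier → Subset
  singleton x c = c ≡ x

module Submission where

-- (i)  Put e = |a| ∧ |b|.  The axiom  x ≤ x · (|a| ∧ |b|)  at x = ¬ e gives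
--      ¬ e ≤ e · ¬ e, and contraposition turns this into
--      |e| = ¬ (e · ¬ e) ≤ ¬ ¬ e = e.  We prove this for any e with
--      ¬ e ≤ ¬ e · e.
-- (ii) Let ↑a be the set of c with a ∧ |d| ≤ c for some d.  Every deductive
--      filter containing a contains all a ∧ |d| and is upward closed, so it
--      contains ↑a.  Conversely ↑a is itself a deductive filter containing a:
--      the only nontrivial point is closure under ∧, where two witnesses d₁, d₂
--      are merged into the single witness |d₁| ∧ |d₂| using (i).
-- (iii) By (ii) both sides are described by witnesses.  The same merging of
--      witnesses, together with distributivity, proves ⊆; the converse holds
--      because a ∧ |d| ≤ (a ∨ b) ∧ |d|, and likewise for b.

open import Defs
open import Level using (Level)
open import Data.Product using (_×_; ∃; _,_; proj₁)
open import Data.Product.Function.NonDependent.Propositional using (_×-⇔_)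
open import Function.Bundles using (_⇔_; mk⇔)
import Function.Properties.Equivalence as ⇔
open import Relation.Binary.PropositionalEquality using (_≡_; refl; sym; subst)
open import Algebra.Structures using (IsCommutativeSemigroup)
open import Algebra.Lattice.Bundles using (Lattice)
open import Algebra.Lattice.Structures using (IsDistributiveLattice)
open import Algebra.Lattice.Properties.Lattice using (∨-∧-orderTheoreticLattice)
import Relation.Binary.Lattice as OrderTheoretic

-- The order x ≤ y (x ∧ y ≡ x) of Defs is the converse-equation form of the
-- library's natural order x ≡ x ∧ y, so the library's lattice-order lemmas
-- transfer through `sym`.
module LatticeOrder {ℓ : Level} (𝐀 : RelevantAlgebra ℓ) where
  open RelevantAlgebra 𝐀

  private
    lattice : Lattice ℓ ℓ
    lattice = record { isLattice = IsDistributiveLattice.isLattice isDistributiveLattice }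

    open OrderTheoretic.Lattice (∨-∧-orderTheoreticLattice lattice)
      using (trans; x∧y≤x; x∧y≤y; ∧-greatest; x≤x∨y; y≤x∨y; ∨-least)

  ≤-trans : ∀ {x y z} → x ≤ y → y ≤ z → x ≤ z
  ≤-trans p q = sym (trans (sym p) (sym q))

  ∧-lowerˡ : ∀ x y → x ∧ y ≤ x
  ∧-lowerˡ x y = sym (x∧y≤x x y)

  ∧-lowerʳ : ∀ x y → x ∧ y ≤ y
  ∧-lowerʳ x y = sym (x∧y≤y x y)

  ∧-greatest′ : ∀ {x y z} → x ≤ y → x ≤ z → x ≤ y ∧ z
  ∧-greatest′ p q = sym (∧-greatest (sym p) (sym q))

  ∨-upperˡ : ∀ x y → x ≤ x ∨ y
  ∨-upperˡ x y = sym (x≤x∨y x y)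

  ∨-upperʳ : ∀ x y → y ≤ x ∨ y
  ∨-upperʳ x y = sym (y≤x∨y x y)

  ∨-least′ : ∀ {x y z} → x ≤ z → y ≤ z → x ∨ y ≤ z
  ∨-least′ p q = sym (∨-least (sym p) (sym q))

  ∧-monoʳ : ∀ x {y z} → y ≤ z → x ∧ y ≤ x ∧ z
  ∧-monoʳ x {y} p = ∧-greatest′ (∧-lowerˡ x y) (≤-trans (∧-lowerʳ x y) p)

  ∧-monoˡ : ∀ {x y} z → x ≤ y → x ∧ z ≤ y ∧ z
  ∧-monoˡ {x} z p = ∧-greatest′ (≤-trans (∧-lowerˡ x z) p) (∧-lowerʳ x z)

module Proof {ℓ : Level} (𝐀 : RelevantAlgebra ℓ) where
  open RelevantAlgebra 𝐀
  open LatticeOrder 𝐀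
  open IsCommutativeSemigroup ·-isCommutativeSemigroup using (comm)
  open IsDistributiveLattice isDistributiveLattice using (∧-distribʳ-∨)

  -- If multiplying ¬ e by e does not decrease it, then e dominates its own
  -- absolute value: contraposing ¬ e ≤ e · ¬ e gives |e| ≤ ¬ ¬ e = e.
  abs-below : ∀ e → ¬ e ≤ ¬ e · e → ∣ e ∣ ≤ e
  abs-below e h = subst (∣ e ∣ ≤_) (¬¬-involutive e) (contrapose h′)
    where
    h′ : ¬ e ≤ e · ¬ e
    h′ = subst (¬ e ≤_) (comm (¬ e) e) h
    contrapose : ¬ e ≤ e · ¬ e → ¬ (e · ¬ e) ≤ ¬ (¬ e)
    contrapose = proj₁ (¬-antitone (¬ e) (e · ¬ e))

  -- Part (i): the axiom  x ≤ x · (|d₁| ∧ |d₂|)  at x = ¬ (|d₁| ∧ |d₂|).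
  abs-of-abs-meet : ∀ d₁ d₂ → ∣ ∣ d₁ ∣ ∧ ∣ d₂ ∣ ∣ ≤ ∣ d₁ ∣ ∧ ∣ d₂ ∣
  abs-of-abs-meet d₁ d₂ = abs-below (∣ d₁ ∣ ∧ ∣ d₂ ∣) (identity-bound _ d₁ d₂)

  Above : Carrier → Carrier → Set ℓ
  Above a c = ∃ λ d → a ∧ ∣ d ∣ ≤ c

  merge-witnesses : ∀ {a b c c′ d₁ d₂} → a ∧ ∣ d₁ ∣ ≤ c → b ∧ ∣ d₂ ∣ ≤ c′ →
    let e = ∣ d₁ ∣ ∧ ∣ d₂ ∣ in (a ∧ ∣ e ∣ ≤ c) × (b ∧ ∣ e ∣ ≤ c′)
  merge-witnesses {a} {b} {d₁ = d₁} {d₂} p q =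
      ≤-trans (∧-monoʳ a (≤-trans (abs-of-abs-meet d₁ d₂) (∧-lowerˡ _ _))) p
    , ≤-trans (∧-monoʳ b (≤-trans (abs-of-abs-meet d₁ d₂) (∧-lowerʳ _ _))) q

  Above-isDeductiveFilter : ∀ a → IsDeductiveFilter 𝐀 (Above a)
  Above-isDeductiveFilter a = record
    { isLatticeFilter = record
      { nonempty  = a , a , ∧-lowerˡ a ∣ a ∣
      ; up-closed = λ _ _ (d , p) q → d , ≤-trans p q
      ; ∧-closed  = λ _ _ (d₁ , p) (d₂ , q) →
          let p′ , q′ = merge-witnesses p q in _ , ∧-greatest′ p′ q′
      }
    ; contains-abs = λ x → x , ∧-lowerʳ a ∣ x ∣
    }

  Above-least : ∀ a {F} → IsDeductiveFilter 𝐀 F → F a → ∀ c → Above a c → F c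
  Above-least a isF Fa c (d , p) =
    up-closed _ c (∧-closed a ∣ d ∣ Fa (contains-abs d)) p
    where
    open IsDeductiveFilter isF
    open IsLatticeFilter isLatticeFilter

  DFg-singleton : ∀ a c → DFg 𝐀 (singleton 𝐀 a) c ⇔ Above a c
  DFg-singleton a c = mk⇔
    (λ h → h (Above a) (Above-isDeductiveFilter a) a∈Above)
    (λ above F isF sub → Above-least a isF (sub a refl) c above)
    where
    a∈Above : ∀ x → x ≡ a → Above a x
    a∈Above x refl = a , ∧-lowerˡ a ∣ a ∣

  Above-∨ : ∀ a b c → (Above a c × Above b c) ⇔ Above (a ∨ b) c
  Above-∨ a b c = mk⇔ join split
    where
    join : Above a c × Above b c → Above (a ∨ b) c
    join ((d₁ , p) , (d₂ , q)) =
      let p′ , q′ = merge-witnesses p q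
      in _ , subst (_≤ c) (sym (∧-distribʳ-∨ _ a b)) (∨-least′ p′ q′)
    split : Above (a ∨ b) c → Above a c × Above b c
    split (d , p) =
        (d , ≤-trans (∧-monoˡ ∣ d ∣ (∨-upperˡ a b)) p)
      , (d , ≤-trans (∧-monoˡ ∣ d ∣ (∨-upperʳ a b)) p)

  DFg-∨ : ∀ a b c →
    (DFg 𝐀 (singleton 𝐀 a) c × DFg 𝐀 (singleton 𝐀 b) c) ⇔ DFg 𝐀 (singleton 𝐀 (a ∨ b)) c
  DFg-∨ a b c =
    ⇔.trans (DFg-singleton a c ×-⇔ DFg-singleton b c)
      (⇔.trans (Above-∨ a b c) (⇔.sym (DFg-singleton (a ∨ b) c)))

theorem7p10 : {ℓ : Level} (𝐀 : RelevantAlgebra ℓ) → let open RelevantAlgebra 𝐀 in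
    (a b : Carrier) →
      (∣ ∣ a ∣ ∧ ∣ b ∣ ∣ ≤ ∣ a ∣ ∧ ∣ b ∣)
      × (∀ c → DFg 𝐀 (singleton 𝐀 a) c ⇔ (∃ λ d → a ∧ ∣ d ∣ ≤ c))
      × (∀ c → (DFg 𝐀 (singleton 𝐀 a) c × DFg 𝐀 (singleton 𝐀 b) c) ⇔ DFg 𝐀 (singleton 𝐀 (a ∨ b)) c)
theorem7p10 𝐀 a b = abs-of-abs-meet a b , DFg-singleton a , DFg-∨ a b
  where open Proof 𝐀
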